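{- Let $n\geq 9$ be odd. Then there exists an $\mathrm{SH}^*(n;8)$.
   Context: An $\mathrm{H}(n;k)$ is an $n\times n$ partially filled array with entries in $\{\pm1,\dots,\pm nk\}\subset\mathbb{Z}$ such that no two entries agree in absolute value, each row and each column has exactly $k$ filled cells, and every row and every column sums to $0$ in $\mathbb{Z}$. An ordering $(a_1,\dots,a_k)$ is simple modulo $v$ if its partial sums $s_i=\sum_{j\le i}a_j$ are pairwise distinct modulo $v$. An $\mathrm{SH}^*(n;k)$ is an $\mathrm{H}(n;k)$ in which the natural ordering of each row (left to right, skipping empty cells) and each column (top to bottom, skipping empty cells) is simple both modulo $2nk+1$ and modulo $2nk+2$. -}

module Defs where

open import Data.Nat as ℕ using (ℕ; suc; NonZero)
open import Data.Integer as ℤ using (ℤ; +_; ∣_∣; _%ℕ_)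
open import Data.Fin using (Fin)
open import Data.Maybe using (Maybe; just; nothing)
open import Data.List using (List; []; _∷_; length; foldr; map; tabulate; catMaybes)
open import Data.List.Relation.Unary.Unique.Propositional using (Unique)
open import Data.Product using (_×_; _,_)
open import Relation.Binary.PropositionalEquality using (_≡_)

PArray : ℕ → Set
PArray n = Fin n → Fin n → Maybe ℤ

rowEntries : ∀ {n} → PArray n → Fin n → List ℤ
rowEntries A i = catMaybes (tabulate (λ j → A i j))

colEntries : ∀ {n} → PArray n → Fin n → List ℤ
colEntries A j = catMaybes (tabulate (λ i → A i j))

sumℤ : List ℤ → ℤ
sumℤ = foldr ℤ._+_ (+ 0)

partialSums : List ℤ → List ℤ
partialSums = go (+ 0)
  where
  go : ℤ → List ℤ → List ℤ
  go s [] = []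
  go s (a ∷ as) = (s ℤ.+ a) ∷ go (s ℤ.+ a) as

SimpleMod : (v : ℕ) → .{{NonZero v}} → List ℤ → Set
SimpleMod v xs = Unique (map (λ s → s %ℕ v) (partialSums xs))

EntriesInRange : ∀ {n} → ℕ → PArray n → Set
EntriesInRange {n} k A =
  ∀ i j x → A i j ≡ just x → (1 ℕ.≤ ∣ x ∣) × (∣ x ∣ ℕ.≤ n ℕ.* k)

DistinctAbs : ∀ {n} → PArray n → Set
DistinctAbs A =
  ∀ i j i' j' x y → A i j ≡ just x → A i' j' ≡ just y →
    ∣ x ∣ ≡ ∣ y ∣ → (i ≡ i') × (j ≡ j')

record IsHeffter (n k : ℕ) (A : PArray n) : Set where
  field
    inRange   : EntriesInRange k A
    distinct  : DistinctAbs A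
    rowSize   : ∀ i → length (rowEntries A i) ≡ k
    colSize   : ∀ j → length (colEntries A j) ≡ k
    rowSum    : ∀ i → sumℤ (rowEntries A i) ≡ + 0
    colSum    : ∀ j → sumℤ (colEntries A j) ≡ + 0

record IsSHStar (n k : ℕ) (A : PArray n) : Set where
  field
    heffter    : IsHeffter n k A
    rowSimple₁ : ∀ i → SimpleMod (suc (2 ℕ.* n ℕ.* k)) (rowEntries A i)
    rowSimple₂ : ∀ i → SimpleMod (suc (suc (2 ℕ.* n ℕ.* k))) (rowEntries A i)
    colSimple₁ : ∀ j → SimpleMod (suc (2 ℕ.* n ℕ.* k)) (colEntries A j)
    colSimple₂ : ∀ j → SimpleMod (suc (suc (2 ℕ.* n ℕ.* k))) (colEntries A j)

-- Write n = s + 8a with s ∈ {9, 11, 13, 15}. An SH*(n;8) is the block-diagonal sum of an explicit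
-- SH*(s;8) and a copies of one explicit 8×8 array, the absolute values of each block raised past
-- those of the blocks before it. A line whose partial sums are distinct integers in [-M, M] is
-- simple modulo every v > 2M, and with M = 8n this covers both moduli 16n+1 and 16n+2.
-- Raising the absolute values in a line is harmless when the line alternates in sign and its
-- odd-indexed partial sums all lie above its even-indexed ones: a raise by c then adds c to
-- every odd-indexed partial sum and fixes the even-indexed ones, preserving both properties.
-- The 8×8 block is chosen with all its lines of this kind.

module Submission where

open import Defs
open import Data.Nat as ℕ using (ℕ; zero; suc; NonZero; s≤s; _≤_; _%_)
import Data.Nat.Properties as ℕP
open import Data.Nat.Divisibility using (divides; n∣m⇒m%n≡0) renaming (_∣_ to _∣ℕ_)
open import Data.Nat.DivMod using (m<n⇒m%n≡m)
open import Data.Integer as ℤ using (ℤ; +_; +[1+_]; -[1+_]; ∣_∣; _%ℕ_; _/ℕ_; _+_; _-_; -_; _*_; _<_)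
import Data.Integer.Properties as ℤP
open import Data.Integer.DivMod using (a≡a%ℕn+[a/ℕn]*n)
open import Data.Integer.Solver using (module +-*-Solver)
open +-*-Solver using (solve; _:+_; _:-_; _:*_; _:=_)
open import Data.Fin as Fin using (Fin; _↑ˡ_; _↑ʳ_; splitAt)
import Data.Fin.Properties as FinP
open import Data.Maybe as Maybe using (Maybe; just; nothing; _<∣>_)
import Data.Maybe.Properties as MaybeP
open import Data.Maybe.Relation.Unary.All as MaybeAll using (just)
open import Data.List as List using (List; []; _∷_; _++_; map; tabulate; catMaybes)
import Data.List.Properties as ListP
open import Data.List.Relation.Unary.All as All using (All; []; _∷_)
import Data.List.Relation.Unary.All.Properties as AllP
open import Data.List.Relation.Unary.Unique.Propositional using (Unique; []; _∷_)
import Data.List.Relation.Unary.Unique.Propositional.Properties as UniqueP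
open import Data.List.Relation.Unary.Unique.DecPropositional ℤP._≟_ using (unique?)
open import Data.Vec as Vec using (Vec; []; _∷_)
open import Data.Bool using (if_then_else_)
open import Data.Empty using (⊥-elim)
open import Data.Product as Product using (Σ; ∃; _×_; _,_; proj₁; proj₂)
import Data.Product.Properties as ProductP
open import Data.Sum using (_⊎_; inj₁; inj₂)
open import Algebra.Bundles using (AbelianGroup)
open import Algebra.Properties.Group (AbelianGroup.group ℤP.+-0-abelianGroup) using (∙-cancelʳ)
open import Function using (_∘_)
open import Relation.Nullary using (Dec; yes; no)
open import Relation.Nullary.Decidable using (map′; _×-dec_; _⊎-dec_; True; toWitness)
open import Relation.Binary.PropositionalEquality
  using (_≡_; _≢_; refl; sym; trans; cong; cong₂; subst; subst₂; ≢-sym; module ≡-Reasoning)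

-- Partial sums

sums : ℤ → List ℤ → List ℤ
sums s [] = []
sums s (a ∷ as) = s + a ∷ sums (s + a) as

sums-neg : ∀ s r → sums (- s) (map -_ r) ≡ map -_ (sums s r)
sums-neg s [] = refl
sums-neg s (a ∷ r) rewrite sym (ℤP.neg-distrib-+ s a) = cong (- (s + a) ∷_) (sums-neg (s + a) r)

sum-neg : ∀ r → sumℤ (map -_ r) ≡ - sumℤ r
sum-neg [] = refl
sum-neg (a ∷ r) = trans (cong (_+_ (- a)) (sum-neg r)) (sym (ℤP.neg-distrib-+ a (sumℤ r)))

mutual
  odds : ∀ {A : Set} → List A → List A
  odds [] = []
  odds (x ∷ xs) = x ∷ evens xs

  evens : ∀ {A : Set} → List A → List A
  evens [] = []
  evens (x ∷ xs) = odds xs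

module _ {A : Set} where

  interleave-all : ∀ {P : A → Set} l → All P (odds l) → All P (evens l) → All P l
  interleave-all [] _ _ = []
  interleave-all (x ∷ []) (px ∷ []) [] = px ∷ []
  interleave-all (x ∷ y ∷ l) (px ∷ po) (py ∷ pe) = px ∷ py ∷ interleave-all l po pe

  interleave-unique : ∀ l → Unique (odds l) → Unique (evens l) →
                      All (λ e → All (e ≢_) (odds l)) (evens l) → Unique l
  interleave-unique [] _ _ _ = []
  interleave-unique (x ∷ []) _ _ _ = [] ∷ []
  interleave-unique (x ∷ y ∷ l) (x∉o ∷ uo) (y∉e ∷ ue) ((y≢x ∷ y∉o) ∷ disjoint) =
    (≢-sym y≢x ∷ interleave-all l x∉o (All.map (≢-sym ∘ All.head) disjoint))
    ∷ interleave-all l y∉o y∉e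
    ∷ interleave-unique l uo ue (All.map All.tail disjoint)

Bounded : ℕ → List ℤ → Set
Bounded M = All (λ s → ∣ s ∣ ℕ.≤ M)

bounded-mono : ∀ {M M′ l} → M ℕ.≤ M′ → Bounded M l → Bounded M′ l
bounded-mono M≤M′ = All.map (λ b → ℕP.≤-trans b M≤M′)

DistinctWithin : ℕ → List ℤ → Set
DistinctWithin M l = Unique l × Bounded M l

distinctWithin-mono : ∀ {M M′ l} → M ℕ.≤ M′ → DistinctWithin M l → DistinctWithin M′ l
distinctWithin-mono M≤M′ (u , b) = u , bounded-mono M≤M′ b

distinctWithin-neg : ∀ {M} l → DistinctWithin M (map -_ l) → DistinctWithin M l
distinctWithin-neg l (u , b) =
  UniqueP.map⁻ u , All.map (λ {x} b′ → subst (ℕ._≤ _) (ℤP.∣-i∣≡∣i∣ x) b′) (AllP.map⁻ b)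

%ℕ-injective : ∀ {M} v .{{_ : NonZero v}} → M ℕ.+ M ℕ.< v → ∀ {x y} →
               ∣ x ∣ ℕ.≤ M → ∣ y ∣ ℕ.≤ M → x %ℕ v ≡ y %ℕ v → x ≡ y
%ℕ-injective {M} v 2M<v {x} {y} bx by same = ℤP.i-j≡0⇒i≡j x y (ℤP.∣i∣≡0⇒i≡0 ∣x-y∣≡0)
  where
  d = x /ℕ v - y /ℕ v
  x-y≡d*v : x - y ≡ d * + v
  x-y≡d*v = begin
    x - y
      ≡⟨ cong₂ _-_ (a≡a%ℕn+[a/ℕn]*n x v) (a≡a%ℕn+[a/ℕn]*n y v) ⟩
    (+ (x %ℕ v) + x /ℕ v * + v) - (+ (y %ℕ v) + y /ℕ v * + v)
      ≡⟨ cong (λ r → (+ (x %ℕ v) + x /ℕ v * + v) - (+ r + y /ℕ v * + v)) (sym same) ⟩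
    (+ (x %ℕ v) + x /ℕ v * + v) - (+ (x %ℕ v) + y /ℕ v * + v)
      ≡⟨ solve 4 (λ r a b w → (r :+ a :* w) :- (r :+ b :* w) := (a :- b) :* w) refl
               (+ (x %ℕ v)) (x /ℕ v) (y /ℕ v) (+ v) ⟩
    d * + v ∎
    where open ≡-Reasoning
  ∣x-y∣<v : ∣ x - y ∣ ℕ.< v
  ∣x-y∣<v = ℕP.≤-<-trans (ℕP.≤-trans (ℤP.∣i-j∣≤∣i∣+∣j∣ x y) (ℕP.+-mono-≤ bx by)) 2M<v
  v∣∣x-y∣ : v ∣ℕ ∣ x - y ∣
  v∣∣x-y∣ = divides ∣ d ∣ (trans (cong ∣_∣ x-y≡d*v) (ℤP.abs-* d (+ v)))
  ∣x-y∣≡0 : ∣ x - y ∣ ≡ 0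
  ∣x-y∣≡0 = trans (sym (m<n⇒m%n≡m ∣x-y∣<v)) (n∣m⇒m%n≡0 ∣ x - y ∣ v v∣∣x-y∣)

distinctWithin-mod : ∀ {M} v .{{_ : NonZero v}} → M ℕ.+ M ℕ.< v →
                     ∀ {l} → DistinctWithin M l → Unique (map (_%ℕ v) l)
distinctWithin-mod v 2M<v ([] , []) = []
distinctWithin-mod v 2M<v (x∉ ∷ u , bx ∷ b) =
  AllP.map⁺ (All.zipWith (λ (x≢y , by) → x≢y ∘ %ℕ-injective v 2M<v bx by) (x∉ , b))
  ∷ distinctWithin-mod v 2M<v (u , b)

record SimpleLine (k M : ℕ) (r : List ℤ) : Set where
  field
    length≡k : List.length r ≡ k
    sum≡0    : sumℤ r ≡ + 0
    distinct : DistinctWithin M (partialSums r)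

simpleLine-mono : ∀ {k M M′ r} → M ℕ.≤ M′ → SimpleLine k M r → SimpleLine k M′ r
simpleLine-mono M≤M′ line = record
  { length≡k = length≡k ; sum≡0 = sum≡0 ; distinct = distinctWithin-mono M≤M′ distinct }
  where open SimpleLine line

simpleLine⇒simpleMod : ∀ {k M r} v .{{_ : NonZero v}} → M ℕ.+ M ℕ.< v → SimpleLine k M r → SimpleMod v r
simpleLine⇒simpleMod v 2M<v line = distinctWithin-mod v 2M<v (SimpleLine.distinct line)

-- Raising absolute values

shiftAbs : ℕ → ℤ → ℤ
shiftAbs c (+ zero) = + zero
shiftAbs c +[1+ m ] = +[1+ m ℕ.+ c ]
shiftAbs c -[1+ m ] = -[1+ m ℕ.+ c ]

shiftAbs-odd : ∀ c x → shiftAbs c (- x) ≡ - shiftAbs c x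
shiftAbs-odd c (+ zero) = refl
shiftAbs-odd c +[1+ m ] = refl
shiftAbs-odd c -[1+ m ] = refl

shiftAbs-positive : ∀ c {x} → + 0 < x → shiftAbs c x ≡ x + + c
shiftAbs-positive c {+[1+ m ]} _ = refl
shiftAbs-positive c {+ zero} (ℤ.+<+ ())

shiftAbs-negative : ∀ c {x} → x < + 0 → shiftAbs c x ≡ x - + c
shiftAbs-negative zero    { -[1+ m ]} _ = cong -[1+_] (ℕP.+-identityʳ m)
shiftAbs-negative (suc c) { -[1+ m ]} _ = cong -[1+_] (ℕP.+-suc m c)
shiftAbs-negative c {+ n} (ℤ.+<+ ())

∣shiftAbs∣ : ∀ c x → 1 ℕ.≤ ∣ x ∣ → ∣ shiftAbs c x ∣ ≡ ∣ x ∣ ℕ.+ c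
∣shiftAbs∣ c +[1+ m ] _ = refl
∣shiftAbs∣ c -[1+ m ] _ = refl

data Alternating : List ℤ → Set where
  []   : Alternating []
  cons : ∀ {a b r} → + 0 < a → b < + 0 → Alternating r → Alternating (a ∷ b ∷ r)

alternating-shiftAbs : ∀ c {r} → Alternating r → Alternating (map (shiftAbs c) r)
alternating-shiftAbs c [] = []
alternating-shiftAbs c (cons {a} {b} 0<a b<0 alt) =
  cons (subst (+ 0 <_) (sym (shiftAbs-positive c 0<a)) (ℤP.<-≤-trans 0<a (ℤP.i≤i+j a (+ c))))
       (subst (_< + 0) (sym (shiftAbs-negative c b<0)) (ℤP.≤-<-trans (ℤP.i-j≤i b (+ c)) b<0))
       (alternating-shiftAbs c alt)

sum-shiftAbs : ∀ c {r} → Alternating r → sumℤ (map (shiftAbs c) r) ≡ sumℤ r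
sum-shiftAbs c [] = refl
sum-shiftAbs c (cons {a} {b} {r} 0<a b<0 alt)
  rewrite shiftAbs-positive c 0<a | shiftAbs-negative c b<0 | sum-shiftAbs c alt =
  solve 4 (λ a b c t → (a :+ c) :+ ((b :- c) :+ t) := a :+ (b :+ t)) refl a b (+ c) (sumℤ r)

raiseOdds : ℤ → List ℤ → List ℤ
raiseOdds c [] = []
raiseOdds c (x ∷ []) = x + c ∷ []
raiseOdds c (x ∷ y ∷ l) = x + c ∷ y ∷ raiseOdds c l

odds-raiseOdds : ∀ c l → odds (raiseOdds c l) ≡ map (_+ c) (odds l)
odds-raiseOdds c [] = refl
odds-raiseOdds c (x ∷ []) = refl
odds-raiseOdds c (x ∷ y ∷ l) = cong (x + c ∷_) (odds-raiseOdds c l)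

evens-raiseOdds : ∀ c l → evens (raiseOdds c l) ≡ evens l
evens-raiseOdds c [] = refl
evens-raiseOdds c (x ∷ []) = refl
evens-raiseOdds c (x ∷ y ∷ l) = cong (y ∷_) (evens-raiseOdds c l)

sums-shiftAbs : ∀ c {r} → Alternating r → ∀ s → sums s (map (shiftAbs c) r) ≡ raiseOdds (+ c) (sums s r)
sums-shiftAbs c [] s = refl
sums-shiftAbs c (cons {a} {b} 0<a b<0 alt) s
  rewrite shiftAbs-positive c 0<a | shiftAbs-negative c b<0 =
  cong₂ _∷_ (solve 3 (λ s a c → s :+ (a :+ c) := s :+ a :+ c) refl s a (+ c))
    (cong₂ _∷_ same-even (trans (cong (λ t → sums t _) same-even) (sums-shiftAbs c alt (s + a + b))))
  where
  same-even : s + (a + + c) + (b - + c) ≡ s + a + b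
  same-even = solve 4 (λ s a b c → s :+ (a :+ c) :+ (b :- c) := s :+ a :+ b) refl s a b (+ c)

record Staggered (M : ℕ) (upper lower : List ℤ) : Set where
  field
    upper-unique  : Unique upper
    lower-unique  : Unique lower
    lower<upper   : All (λ e → All (e <_) upper) lower
    upper-bounded : Bounded M upper
    lower-bounded : Bounded M lower

staggered-mono : ∀ {M M′ U L} → M ℕ.≤ M′ → Staggered M U L → Staggered M′ U L
staggered-mono M≤M′ st = record
  { upper-unique = upper-unique ; lower-unique = lower-unique ; lower<upper = lower<upper
  ; upper-bounded = bounded-mono M≤M′ upper-bounded ; lower-bounded = bounded-mono M≤M′ lower-bounded }
  where open Staggered st

staggered-raise : ∀ {M U L} c → Staggered M U L → Staggered (M ℕ.+ c) (map (_+ + c) U) L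
staggered-raise {M} c st = record
  { upper-unique = UniqueP.map⁺ (λ {x} {y} → ∙-cancelʳ (+ c) x y) upper-unique
  ; lower-unique = lower-unique
  ; lower<upper =
      All.map (λ e<U → AllP.map⁺ (All.map (λ {u} e<u → ℤP.<-≤-trans e<u (ℤP.i≤i+j u (+ c))) e<U)) lower<upper
  ; upper-bounded =
      AllP.map⁺ (All.map (λ {u} b → ℕP.≤-trans (ℤP.∣i+j∣≤∣i∣+∣j∣ u (+ c)) (ℕP.+-monoˡ-≤ c b)) upper-bounded)
  ; lower-bounded = bounded-mono (ℕP.m≤m+n M c) lower-bounded }
  where open Staggered st

staggered⇒distinctWithin : ∀ {M} l → Staggered M (odds l) (evens l) → DistinctWithin M l
staggered⇒distinctWithin l st =
  interleave-unique l upper-unique lower-unique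
    (All.map (All.map (λ e<o e≡o → ℤP.<-irrefl e≡o e<o)) lower<upper) ,
  interleave-all l upper-bounded lower-bounded
  where open Staggered st

record Zigzag (M : ℕ) (r : List ℤ) : Set where
  field
    alternating : Alternating r
    sum≡0       : sumℤ r ≡ + 0
    staggered   : Staggered M (odds (sums (+ 0) r)) (evens (sums (+ 0) r))

zigzag-mono : ∀ {M M′ r} → M ℕ.≤ M′ → Zigzag M r → Zigzag M′ r
zigzag-mono M≤M′ z = record
  { alternating = alternating ; sum≡0 = sum≡0 ; staggered = staggered-mono M≤M′ staggered }
  where open Zigzag z

zigzag-shiftAbs : ∀ {M r} c → Zigzag M r → Zigzag (M ℕ.+ c) (map (shiftAbs c) r)
zigzag-shiftAbs {r = r} c z = record
  { alternating = alternating-shiftAbs c alternating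
  ; sum≡0 = trans (sum-shiftAbs c alternating) sum≡0
  ; staggered = subst₂ (Staggered _)
      (sym (trans (cong odds sums≡) (odds-raiseOdds (+ c) (sums (+ 0) r))))
      (sym (trans (cong evens sums≡) (evens-raiseOdds (+ c) (sums (+ 0) r))))
      (staggered-raise c staggered) }
  where
  open Zigzag z
  sums≡ = sums-shiftAbs c alternating (+ 0)

zigzag⇒distinctWithin : ∀ {M r} → Zigzag M r → DistinctWithin M (sums (+ 0) r)
zigzag⇒distinctWithin {r = r} z = staggered⇒distinctWithin (sums (+ 0) r) (Zigzag.staggered z)

ZigzagLine : ℕ → ℕ → List ℤ → Set
ZigzagLine k M r = List.length r ≡ k × (Zigzag M r ⊎ Zigzag M (map -_ r))

zigzagLine-mono : ∀ {k M M′ r} → M ℕ.≤ M′ → ZigzagLine k M r → ZigzagLine k M′ r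
zigzagLine-mono M≤M′ (len , inj₁ z) = len , inj₁ (zigzag-mono M≤M′ z)
zigzagLine-mono M≤M′ (len , inj₂ z) = len , inj₂ (zigzag-mono M≤M′ z)

zigzagLine-shiftAbs : ∀ {k M r} c → ZigzagLine k M r → ZigzagLine k (M ℕ.+ c) (map (shiftAbs c) r)
zigzagLine-shiftAbs {r = r} c (len , z) = trans (ListP.length-map (shiftAbs c) r) len , shifted z
  where
  shiftAbs-commutes : map (shiftAbs c) (map -_ r) ≡ map -_ (map (shiftAbs c) r)
  shiftAbs-commutes = begin
    map (shiftAbs c) (map -_ r) ≡⟨ ListP.map-∘ r ⟨
    map (shiftAbs c ∘ -_) r     ≡⟨ ListP.map-cong (shiftAbs-odd c) r ⟩
    map (-_ ∘ shiftAbs c) r     ≡⟨ ListP.map-∘ r ⟩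
    map -_ (map (shiftAbs c) r) ∎
    where open ≡-Reasoning
  shifted : ∀ {M} → Zigzag M r ⊎ Zigzag M (map -_ r) →
            Zigzag (M ℕ.+ c) (map (shiftAbs c) r) ⊎ Zigzag (M ℕ.+ c) (map -_ (map (shiftAbs c) r))
  shifted (inj₁ z) = inj₁ (zigzag-shiftAbs c z)
  shifted (inj₂ z) = inj₂ (subst (Zigzag _) shiftAbs-commutes (zigzag-shiftAbs c z))

-- partialSums hides its accumulator in a local helper, so it can be matched
-- with sums only by computation on lines of a fixed length.
partialSums≡sums : ∀ r → List.length r ≡ 8 → partialSums r ≡ sums (+ 0) r
partialSums≡sums (_ ∷ _ ∷ _ ∷ _ ∷ _ ∷ _ ∷ _ ∷ _ ∷ []) _ = refl
partialSums≡sums [] ()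
partialSums≡sums (_ ∷ []) ()
partialSums≡sums (_ ∷ _ ∷ []) ()
partialSums≡sums (_ ∷ _ ∷ _ ∷ []) ()
partialSums≡sums (_ ∷ _ ∷ _ ∷ _ ∷ []) ()
partialSums≡sums (_ ∷ _ ∷ _ ∷ _ ∷ _ ∷ []) ()
partialSums≡sums (_ ∷ _ ∷ _ ∷ _ ∷ _ ∷ _ ∷ []) ()
partialSums≡sums (_ ∷ _ ∷ _ ∷ _ ∷ _ ∷ _ ∷ _ ∷ []) ()
partialSums≡sums (_ ∷ _ ∷ _ ∷ _ ∷ _ ∷ _ ∷ _ ∷ _ ∷ _ ∷ _) ()

zigzagLine⇒simpleLine : ∀ {M r} → ZigzagLine 8 M r → SimpleLine 8 M r
zigzagLine⇒simpleLine {M} {r} (len , z) = record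
  { length≡k = len
  ; sum≡0 = zero-sum z
  ; distinct = subst (DistinctWithin M) (sym (partialSums≡sums r len)) (distinct-sums z) }
  where
  zero-sum : Zigzag M r ⊎ Zigzag M (map -_ r) → sumℤ r ≡ + 0
  zero-sum (inj₁ z) = Zigzag.sum≡0 z
  zero-sum (inj₂ z) = ℤP.neg-injective (trans (sym (sum-neg r)) (Zigzag.sum≡0 z))
  distinct-sums : Zigzag M r ⊎ Zigzag M (map -_ r) → DistinctWithin M (sums (+ 0) r)
  distinct-sums (inj₁ z) = zigzag⇒distinctWithin z
  distinct-sums (inj₂ z) =
    distinctWithin-neg (sums (+ 0) r) (subst (DistinctWithin M) (sums-neg (+ 0) r) (zigzag⇒distinctWithin z))

-- Block-diagonal sums of arrays

record Linewise (P : ℕ → List ℤ → Set) (n k : ℕ) (A : PArray n) : Set where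
  field
    inRange  : EntriesInRange k A
    distinct : DistinctAbs A
    rows     : ∀ i → P (n ℕ.* k) (rowEntries A i)
    cols     : ∀ j → P (n ℕ.* k) (colEntries A j)

nk+nk<2nk+1 : ∀ n k → n ℕ.* k ℕ.+ n ℕ.* k ℕ.< suc (2 ℕ.* n ℕ.* k)
nk+nk<2nk+1 n k = s≤s (ℕP.≤-reflexive (begin
  n ℕ.* k ℕ.+ n ℕ.* k         ≡⟨ cong (n ℕ.* k ℕ.+_) (ℕP.+-identityʳ (n ℕ.* k)) ⟨
  2 ℕ.* (n ℕ.* k)             ≡⟨ ℕP.*-assoc 2 n k ⟨
  2 ℕ.* n ℕ.* k               ∎))
  where open ≡-Reasoning

linewise⇒SHStar : ∀ {n k A} → Linewise (SimpleLine k) n k A → IsSHStar n k A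
linewise⇒SHStar {n} {k} L = record
  { heffter = record
    { inRange = inRange
    ; distinct = distinct
    ; rowSize = SimpleLine.length≡k ∘ rows
    ; colSize = SimpleLine.length≡k ∘ cols
    ; rowSum = SimpleLine.sum≡0 ∘ rows
    ; colSum = SimpleLine.sum≡0 ∘ cols }
  ; rowSimple₁ = simpleLine⇒simpleMod _ (nk+nk<2nk+1 n k) ∘ rows
  ; rowSimple₂ = simpleLine⇒simpleMod _ (ℕP.m<n⇒m<1+n (nk+nk<2nk+1 n k)) ∘ rows
  ; colSimple₁ = simpleLine⇒simpleMod _ (nk+nk<2nk+1 n k) ∘ cols
  ; colSimple₂ = simpleLine⇒simpleMod _ (ℕP.m<n⇒m<1+n (nk+nk<2nk+1 n k)) ∘ cols }
  where open Linewise L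

module _ {X : Set} where

  catMaybes-tabulate-++ : ∀ p q (f : Fin (p ℕ.+ q) → Maybe X) →
    catMaybes (tabulate f) ≡ catMaybes (tabulate (f ∘ (_↑ˡ q))) ++ catMaybes (tabulate (f ∘ (p ↑ʳ_)))
  catMaybes-tabulate-++ zero q f = refl
  catMaybes-tabulate-++ (suc p) q f with f Fin.zero
  ... | just x  = cong (x ∷_) (catMaybes-tabulate-++ p q (f ∘ Fin.suc))
  ... | nothing = catMaybes-tabulate-++ p q (f ∘ Fin.suc)

  catMaybes-tabulate-nothing : ∀ {n} (f : Fin n → Maybe X) → (∀ i → f i ≡ nothing) →
                               catMaybes (tabulate f) ≡ []
  catMaybes-tabulate-nothing {zero} f none = refl
  catMaybes-tabulate-nothing {suc n} f none rewrite none Fin.zero =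
    catMaybes-tabulate-nothing (f ∘ Fin.suc) (none ∘ Fin.suc)

  module _ {p q} (f : Fin (p ℕ.+ q) → Maybe X) where

    line-left : (g : Fin p → Maybe X) → (∀ a → f (a ↑ˡ q) ≡ g a) → (∀ b → f (p ↑ʳ b) ≡ nothing) →
                catMaybes (tabulate f) ≡ catMaybes (tabulate g)
    line-left g on-left off-right = begin
      catMaybes (tabulate f)
        ≡⟨ catMaybes-tabulate-++ p q f ⟩
      catMaybes (tabulate (f ∘ (_↑ˡ q))) ++ catMaybes (tabulate (f ∘ (p ↑ʳ_)))
        ≡⟨ cong₂ _++_ (cong catMaybes (ListP.tabulate-cong on-left)) (catMaybes-tabulate-nothing _ off-right) ⟩
      catMaybes (tabulate g) ++ []
        ≡⟨ ListP.++-identityʳ _ ⟩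
      catMaybes (tabulate g) ∎
      where open ≡-Reasoning

    line-right : (h : X → X) (g : Fin q → Maybe X) → (∀ a → f (a ↑ˡ q) ≡ nothing) →
                 (∀ b → f (p ↑ʳ b) ≡ Maybe.map h (g b)) →
                 catMaybes (tabulate f) ≡ map h (catMaybes (tabulate g))
    line-right h g off-left on-right = begin
      catMaybes (tabulate f)
        ≡⟨ catMaybes-tabulate-++ p q f ⟩
      catMaybes (tabulate (f ∘ (_↑ˡ q))) ++ catMaybes (tabulate (f ∘ (p ↑ʳ_)))
        ≡⟨ cong₂ _++_ (catMaybes-tabulate-nothing _ off-left) (cong catMaybes (ListP.tabulate-cong on-right)) ⟩
      catMaybes (tabulate (Maybe.map h ∘ g))
        ≡⟨ cong catMaybes (ListP.map-tabulate g (Maybe.map h)) ⟨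
      catMaybes (map (Maybe.map h) (tabulate g))
        ≡⟨ ListP.map-catMaybes h (tabulate g) ⟨
      map h (catMaybes (tabulate g)) ∎
      where open ≡-Reasoning

data Split (p q : ℕ) : Fin (p ℕ.+ q) → Set where
  left  : ∀ a → Split p q (a ↑ˡ q)
  right : ∀ b → Split p q (p ↑ʳ b)

split : ∀ p q i → Split p q i
split p q i with splitAt p i in eq
... | inj₁ a = subst (Split p q) (FinP.splitAt⁻¹-↑ˡ eq) (left a)
... | inj₂ b = subst (Split p q) (FinP.splitAt⁻¹-↑ʳ eq) (right b)

_⊕⟨_⟩_ : ∀ {p q} → PArray p → ℕ → PArray q → PArray (p ℕ.+ q)
_⊕⟨_⟩_ {p} {q} A c B i j = diagonal (splitAt p i) (splitAt p j)
  where
  diagonal : Fin p ⊎ Fin q → Fin p ⊎ Fin q → Maybe ℤ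
  diagonal (inj₁ a) (inj₁ b) = A a b
  diagonal (inj₂ a) (inj₂ b) = Maybe.map (shiftAbs c) (B a b)
  diagonal _        _        = nothing

module _ {p q} (A : PArray p) (c : ℕ) (B : PArray q) where

  ⊕-ll : ∀ a b → (A ⊕⟨ c ⟩ B) (a ↑ˡ q) (b ↑ˡ q) ≡ A a b
  ⊕-ll a b rewrite FinP.splitAt-↑ˡ p a q | FinP.splitAt-↑ˡ p b q = refl

  ⊕-lr : ∀ a b → (A ⊕⟨ c ⟩ B) (a ↑ˡ q) (p ↑ʳ b) ≡ nothing
  ⊕-lr a b rewrite FinP.splitAt-↑ˡ p a q | FinP.splitAt-↑ʳ p q b = refl

  ⊕-rl : ∀ a b → (A ⊕⟨ c ⟩ B) (p ↑ʳ a) (b ↑ˡ q) ≡ nothing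
  ⊕-rl a b rewrite FinP.splitAt-↑ʳ p q a | FinP.splitAt-↑ˡ p b q = refl

  ⊕-rr : ∀ a b → (A ⊕⟨ c ⟩ B) (p ↑ʳ a) (p ↑ʳ b) ≡ Maybe.map (shiftAbs c) (B a b)
  ⊕-rr a b rewrite FinP.splitAt-↑ʳ p q a | FinP.splitAt-↑ʳ p q b = refl

  ⊕-row-left : ∀ a → rowEntries (A ⊕⟨ c ⟩ B) (a ↑ˡ q) ≡ rowEntries A a
  ⊕-row-left a = line-left _ (A a) (⊕-ll a) (⊕-lr a)

  ⊕-row-right : ∀ b → rowEntries (A ⊕⟨ c ⟩ B) (p ↑ʳ b) ≡ map (shiftAbs c) (rowEntries B b)
  ⊕-row-right b = line-right _ (shiftAbs c) (B b) (⊕-rl b) (⊕-rr b)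

  ⊕-col-left : ∀ b → colEntries (A ⊕⟨ c ⟩ B) (b ↑ˡ q) ≡ colEntries A b
  ⊕-col-left b = line-left _ (λ a → A a b) (λ a → ⊕-ll a b) (λ a → ⊕-rl a b)

  ⊕-col-right : ∀ b → colEntries (A ⊕⟨ c ⟩ B) (p ↑ʳ b) ≡ map (shiftAbs c) (colEntries B b)
  ⊕-col-right b = line-right _ (shiftAbs c) (λ a → B a b) (λ a → ⊕-lr a b) (λ a → ⊕-rr a b)

  data Filled : Fin (p ℕ.+ q) → Fin (p ℕ.+ q) → ℤ → Set where
    left  : ∀ {a b x} → A a b ≡ just x → Filled (a ↑ˡ q) (b ↑ˡ q) x
    right : ∀ {a b y} → B a b ≡ just y → Filled (p ↑ʳ a) (p ↑ʳ b) (shiftAbs c y)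

  filled : ∀ i j {x} → (A ⊕⟨ c ⟩ B) i j ≡ just x → Filled i j x
  filled i j eq with split p q i | split p q j
  ... | left a  | left b  = left (trans (sym (⊕-ll a b)) eq)
  ... | left a  | right b with () ← trans (sym (⊕-lr a b)) eq
  ... | right a | left b  with () ← trans (sym (⊕-rl a b)) eq
  ... | right a | right b with B a b in e | trans (sym (⊕-rr a b)) eq
  ...   | just y | refl = right e

module _ {P Q : ℕ → List ℤ → Set}
         (P-mono : ∀ {M M′ r} → M ℕ.≤ M′ → P M r → P M′ r)
         (Q-shift : ∀ {M r} c → Q M r → P (M ℕ.+ c) (map (shiftAbs c) r))
         {k p q} {A : PArray p} {B : PArray q} (LA : Linewise P p k A) (LB : Linewise Q q k B) where

  private
    module LA = Linewise LA
    module LB = Linewise LB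
    c = p ℕ.* k
    size≡ : q ℕ.* k ℕ.+ p ℕ.* k ≡ (p ℕ.+ q) ℕ.* k
    size≡ = trans (ℕP.+-comm (q ℕ.* k) c) (sym (ℕP.*-distribʳ-+ k p q))
    p≤p+q : p ℕ.* k ℕ.≤ (p ℕ.+ q) ℕ.* k
    p≤p+q = ℕP.*-monoˡ-≤ k (ℕP.m≤m+n p q)

  ⊕-linewise : Linewise P (p ℕ.+ q) k (A ⊕⟨ p ℕ.* k ⟩ B)
  ⊕-linewise = record { inRange = inRange ; distinct = distinct ; rows = rows ; cols = cols }
    where
    inRange : EntriesInRange k (A ⊕⟨ c ⟩ B)
    inRange i j x eq with filled A c B i j eq
    ... | left e = let (1≤x , x≤pk) = LA.inRange _ _ _ e in 1≤x , ℕP.≤-trans x≤pk p≤p+q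
    ... | right {y = y} e =
      let (1≤y , y≤qk) = LB.inRange _ _ _ e
          ∣y′∣≡ = ∣shiftAbs∣ c y 1≤y
      in subst (1 ℕ.≤_) (sym ∣y′∣≡) (ℕP.≤-trans 1≤y (ℕP.m≤m+n ∣ y ∣ c)) ,
         subst (ℕ._≤ _) (sym ∣y′∣≡) (subst (ℕ._≤_ _) size≡ (ℕP.+-monoˡ-≤ c y≤qk))

    left≢right : ∀ {a b a′ b′ x y} → A a b ≡ just x → B a′ b′ ≡ just y → ∣ x ∣ ≢ ∣ shiftAbs c y ∣
    left≢right {x = x} {y} ex ey same = ℕP.<-irrefl same (begin-strict
      ∣ x ∣              ≤⟨ proj₂ (LA.inRange _ _ _ ex) ⟩
      c                  <⟨ ℕP.+-monoˡ-≤ c (proj₁ (LB.inRange _ _ _ ey)) ⟩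
      ∣ y ∣ ℕ.+ c        ≡⟨ ∣shiftAbs∣ c y (proj₁ (LB.inRange _ _ _ ey)) ⟨
      ∣ shiftAbs c y ∣   ∎)
      where open ℕP.≤-Reasoning

    distinct : DistinctAbs (A ⊕⟨ c ⟩ B)
    distinct i j i′ j′ x x′ ex ex′ same with filled A c B i j ex | filled A c B i′ j′ ex′
    ... | left e | left e′ with LA.distinct _ _ _ _ _ _ e e′ same
    ...   | refl , refl = refl , refl
    distinct _ _ _ _ _ _ _ _ same | right {y = y} e | right {y = y′} e′
      with LB.distinct _ _ _ _ _ _ e e′ (ℕP.+-cancelʳ-≡ c _ _ (begin
             ∣ y ∣ ℕ.+ c       ≡⟨ ∣shiftAbs∣ c y (proj₁ (LB.inRange _ _ _ e)) ⟨
             ∣ shiftAbs c y ∣  ≡⟨ same ⟩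
             ∣ shiftAbs c y′ ∣ ≡⟨ ∣shiftAbs∣ c y′ (proj₁ (LB.inRange _ _ _ e′)) ⟩
             ∣ y′ ∣ ℕ.+ c      ∎))
      where open ≡-Reasoning
    ... | refl , refl = refl , refl
    distinct _ _ _ _ _ _ _ _ same | left e  | right e′ = ⊥-elim (left≢right e e′ same)
    distinct _ _ _ _ _ _ _ _ same | right e | left e′  = ⊥-elim (left≢right e′ e (sym same))

    shifted : ∀ {l} → Q (q ℕ.* k) l → P ((p ℕ.+ q) ℕ.* k) (map (shiftAbs c) l)
    shifted {l} Ql = subst (λ M → P M (map (shiftAbs c) l)) size≡ (Q-shift c Ql)

    rows : ∀ i → P ((p ℕ.+ q) ℕ.* k) (rowEntries (A ⊕⟨ c ⟩ B) i)
    rows i with split p q i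
    ... | left a  = subst (P _) (sym (⊕-row-left A c B a)) (P-mono p≤p+q (LA.rows a))
    ... | right b = subst (P _) (sym (⊕-row-right A c B b)) (shifted (LB.rows b))

    cols : ∀ j → P ((p ℕ.+ q) ℕ.* k) (colEntries (A ⊕⟨ c ⟩ B) j)
    cols j with split p q j
    ... | left a  = subst (P _) (sym (⊕-col-left A c B a)) (P-mono p≤p+q (LA.cols a))
    ... | right b = subst (P _) (sym (⊕-col-right A c B b)) (shifted (LB.cols b))

blockPower : ∀ {p} (k : ℕ) → PArray p → (a : ℕ) → PArray (a ℕ.* p)
blockPower k A zero = λ ()
blockPower {p} k A (suc a) = A ⊕⟨ p ℕ.* k ⟩ blockPower k A a

blockPower-linewise : ∀ {P : ℕ → List ℤ → Set} →
  (∀ {M M′ r} → M ℕ.≤ M′ → P M r → P M′ r) →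
  (∀ {M r} c → P M r → P (M ℕ.+ c) (map (shiftAbs c) r)) →
  ∀ {p k A} → Linewise P p k A → ∀ a → Linewise P (a ℕ.* p) k (blockPower k A a)
blockPower-linewise mono shift LA zero = record { inRange = λ () ; distinct = λ () ; rows = λ () ; cols = λ () }
blockPower-linewise mono shift LA (suc a) = ⊕-linewise mono shift LA (blockPower-linewise mono shift LA a)

-- Certified explicit arrays

bounded? : ∀ M l → Dec (Bounded M l)
bounded? M = All.all? (λ s → ∣ s ∣ ℕP.≤? M)

simpleLine? : ∀ k M r → Dec (SimpleLine k M r)
simpleLine? k M r =
  map′ (λ (len , sum , distinct) → record { length≡k = len ; sum≡0 = sum ; distinct = distinct })
       (λ L → SimpleLine.length≡k L , SimpleLine.sum≡0 L , SimpleLine.distinct L)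
       ((List.length r ℕP.≟ k) ×-dec (sumℤ r ℤP.≟ + 0) ×-dec
        (unique? (partialSums r) ×-dec bounded? M (partialSums r)))

alternating? : ∀ r → Dec (Alternating r)
alternating? [] = yes []
alternating? (_ ∷ []) = no λ ()
alternating? (a ∷ b ∷ r) =
  map′ (λ (0<a , b<0 , alt) → cons 0<a b<0 alt) (λ { (cons 0<a b<0 alt) → 0<a , b<0 , alt })
       ((+ 0 ℤP.<? a) ×-dec (b ℤP.<? + 0) ×-dec alternating? r)

staggered? : ∀ M U L → Dec (Staggered M U L)
staggered? M U L =
  map′ (λ (uU , uL , L<U , bU , bL) → record
         { upper-unique = uU ; lower-unique = uL ; lower<upper = L<U ; upper-bounded = bU ; lower-bounded = bL })
       (λ st → let open Staggered st in upper-unique , lower-unique , lower<upper , upper-bounded , lower-bounded)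
       (unique? U ×-dec unique? L ×-dec All.all? (λ e → All.all? (e ℤP.<?_) U) L ×-dec
        bounded? M U ×-dec bounded? M L)

zigzag? : ∀ M r → Dec (Zigzag M r)
zigzag? M r =
  map′ (λ (alt , sum , st) → record { alternating = alt ; sum≡0 = sum ; staggered = st })
       (λ z → let open Zigzag z in alternating , sum≡0 , staggered)
       (alternating? r ×-dec (sumℤ r ℤP.≟ + 0) ×-dec staggered? M (odds (sums (+ 0) r)) (evens (sums (+ 0) r)))

zigzagLine? : ∀ k M r → Dec (ZigzagLine k M r)
zigzagLine? k M r = (List.length r ℕP.≟ k) ×-dec (zigzag? M r ⊎-dec zigzag? M (map -_ r))

module _ {n} (A : PArray n) (locate : ℕ → Maybe (Fin n × Fin n)) where

  -- Distinct absolute values are certified by a search that locates each absolute value at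
  -- a single cell: every filled cell must be the one found for its entry.
  WellPlaced : ℕ → Fin n → Fin n → ℤ → Set
  WellPlaced k i j x = (1 ℕ.≤ ∣ x ∣ × ∣ x ∣ ℕ.≤ n ℕ.* k) × locate ∣ x ∣ ≡ just (i , j)

  Certified : (ℕ → List ℤ → Set) → ℕ → Set
  Certified P k =
    (∀ i j → MaybeAll.All (WellPlaced k i j) (A i j))
    × (∀ i → P (n ℕ.* k) (rowEntries A i)) × (∀ j → P (n ℕ.* k) (colEntries A j))

  certified? : ∀ {P} → (∀ M r → Dec (P M r)) → ∀ k → Dec (Certified P k)
  certified? P? k =
    FinP.all? (λ i → FinP.all? (λ j → MaybeAll.dec (λ x →
      ((1 ℕP.≤? ∣ x ∣) ×-dec (∣ x ∣ ℕP.≤? n ℕ.* k)) ×-dec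
      MaybeP.≡-dec (ProductP.≡-dec FinP._≟_ FinP._≟_) (locate ∣ x ∣) (just (i , j))) (A i j)))
    ×-dec FinP.all? (λ i → P? (n ℕ.* k) (rowEntries A i))
    ×-dec FinP.all? (λ j → P? (n ℕ.* k) (colEntries A j))

  certified⇒linewise : ∀ {P k} → Certified P k → Linewise P n k A
  certified⇒linewise (cells , rows , cols) = record
    { inRange = λ i j x eq → proj₁ (cell eq)
    ; distinct = λ i j i′ j′ x y ex ey same →
        ProductP.,-injective (MaybeP.just-injective
          (trans (sym (proj₂ (cell ex))) (trans (cong locate same) (proj₂ (cell ey)))))
    ; rows = rows
    ; cols = cols }
    where
    cell : ∀ {i j x} → A i j ≡ just x → WellPlaced _ i j x
    cell {i} {j} eq with just c ← subst (MaybeAll.All _) eq (cells i j) = c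

nonzero : ℤ → Maybe ℤ
nonzero (+ zero) = nothing
nonzero x = just x

fromRows : ∀ {n} → Vec (Vec ℤ n) n → PArray n
fromRows m i j = nonzero (Vec.lookup (Vec.lookup m i) j)

column : ∀ {n} → Vec ℤ n → ℕ → Maybe (Fin n)
column [] v = nothing
column (x ∷ xs) v = if ∣ x ∣ ℕ.≡ᵇ v then just Fin.zero else Maybe.map Fin.suc (column xs v)

position : ∀ {m n} → Vec (Vec ℤ n) m → ℕ → Maybe (Fin m × Fin n)
position [] v = nothing
position (row ∷ rows) v =
  Maybe.map (Fin.zero ,_) (column row v) <∣> Maybe.map (Product.map₁ Fin.suc) (position rows v)

fromRows-linewise : ∀ {P n} (P? : ∀ M r → Dec (P M r)) → ∀ k (m : Vec (Vec ℤ n) n) →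
  {True (certified? (fromRows m) (position m) P? k)} → Linewise P n k (fromRows m)
fromRows-linewise P? k m {ok} = certified⇒linewise (fromRows m) (position m) (toWitness ok)

-- 0 marks an empty cell.
module BaseArrays where
  open import Agda.Builtin.FromNat using (fromNat)
  open import Agda.Builtin.FromNeg using (fromNeg)
  open import Data.Unit.Base using (tt)
  import Data.Nat.Literals as ℕLiterals
  import Data.Integer.Literals as ℤLiterals
  instance
    ℕ-number = ℕLiterals.number
    ℤ-number = ℤLiterals.number
    ℤ-negative = ℤLiterals.negative
    literal-constraint = tt

  H₈ : Vec (Vec ℤ 8) 8
  H₈ =
      ( 30 ∷ -32 ∷  60 ∷ -57 ∷  26 ∷ -28 ∷  35 ∷ -34 ∷ [])
    ∷ (-29 ∷  31 ∷ -59 ∷  58 ∷ -25 ∷  27 ∷ -36 ∷  33 ∷ [])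
    ∷ ( 55 ∷ -54 ∷  20 ∷ -19 ∷  48 ∷ -47 ∷  49 ∷ -52 ∷ [])
    ∷ (-53 ∷  56 ∷ -18 ∷  17 ∷ -46 ∷  45 ∷ -51 ∷  50 ∷ [])
    ∷ ( 61 ∷ -63 ∷  15 ∷ -14 ∷   3 ∷  -1 ∷  42 ∷ -43 ∷ [])
    ∷ (-62 ∷  64 ∷ -16 ∷  13 ∷  -4 ∷   2 ∷ -41 ∷  44 ∷ [])
    ∷ ( 38 ∷ -39 ∷   5 ∷  -6 ∷  21 ∷ -22 ∷  12 ∷  -9 ∷ [])
    ∷ (-40 ∷  37 ∷  -7 ∷   8 ∷ -23 ∷  24 ∷ -10 ∷  11 ∷ [])
    ∷ []

  H₉ : Vec (Vec ℤ 9) 9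
  H₉ =
      (-49 ∷  67 ∷ -63 ∷  41 ∷ -30 ∷  44 ∷ -36 ∷  26 ∷   0 ∷ [])
    ∷ (  0 ∷ -53 ∷  57 ∷ -25 ∷   3 ∷ -54 ∷  48 ∷ -22 ∷  46 ∷ [])
    ∷ ( 56 ∷   0 ∷ -37 ∷  13 ∷ -45 ∷  17 ∷ -16 ∷  64 ∷ -52 ∷ [])
    ∷ (-10 ∷  20 ∷   0 ∷ -47 ∷  69 ∷ -31 ∷  51 ∷ -60 ∷   8 ∷ [])
    ∷ ( 58 ∷ -38 ∷   6 ∷   0 ∷ -11 ∷  55 ∷ -39 ∷   1 ∷ -32 ∷ [])
    ∷ (-62 ∷  50 ∷  -4 ∷  14 ∷   0 ∷ -59 ∷  23 ∷ -27 ∷  65 ∷ [])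
    ∷ ( 21 ∷ -66 ∷  24 ∷ -28 ∷  68 ∷   0 ∷ -71 ∷  61 ∷  -9 ∷ [])
    ∷ (-19 ∷  35 ∷ -12 ∷  34 ∷ -72 ∷  70 ∷   0 ∷ -43 ∷   7 ∷ [])
    ∷ (  5 ∷ -15 ∷  29 ∷  -2 ∷  18 ∷ -42 ∷  40 ∷   0 ∷ -33 ∷ [])
    ∷ []

  H₁₁ : Vec (Vec ℤ 11) 11
  H₁₁ =
      (-55 ∷  77 ∷ -85 ∷  81 ∷ -84 ∷  20 ∷ -12 ∷  58 ∷   0 ∷   0 ∷   0 ∷ [])
    ∷ (  0 ∷ -65 ∷  69 ∷ -19 ∷  41 ∷ -16 ∷  32 ∷ -86 ∷  44 ∷   0 ∷   0 ∷ [])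
    ∷ (  0 ∷   0 ∷ -51 ∷   3 ∷ -35 ∷  39 ∷ -30 ∷  82 ∷ -80 ∷  72 ∷   0 ∷ [])
    ∷ (  0 ∷   0 ∷   0 ∷ -83 ∷  73 ∷ -57 ∷  25 ∷ -22 ∷  66 ∷ -76 ∷  74 ∷ [])
    ∷ ( 46 ∷   0 ∷   0 ∷   0 ∷ -63 ∷  87 ∷ -49 ∷   9 ∷  -6 ∷  40 ∷ -64 ∷ [])
    ∷ (-18 ∷   8 ∷   0 ∷   0 ∷   0 ∷ -23 ∷  47 ∷ -79 ∷  37 ∷ -26 ∷  54 ∷ [])
    ∷ ( 62 ∷ -70 ∷  10 ∷   0 ∷   0 ∷   0 ∷ -61 ∷  71 ∷ -15 ∷  17 ∷ -14 ∷ [])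
    ∷ (-68 ∷  52 ∷  -2 ∷  88 ∷   0 ∷   0 ∷   0 ∷ -33 ∷  21 ∷ -59 ∷   1 ∷ [])
    ∷ (  7 ∷  -4 ∷  38 ∷ -56 ∷  60 ∷   0 ∷   0 ∷   0 ∷ -67 ∷  75 ∷ -53 ∷ [])
    ∷ ( -5 ∷  13 ∷ -24 ∷  36 ∷ -34 ∷  28 ∷   0 ∷   0 ∷   0 ∷ -43 ∷  29 ∷ [])
    ∷ ( 31 ∷ -11 ∷  45 ∷ -50 ∷  42 ∷ -78 ∷  48 ∷   0 ∷   0 ∷   0 ∷ -27 ∷ [])
    ∷ []

  H₁₃ : Vec (Vec ℤ 13) 13
  H₁₃ =
      ( -77 ∷  101 ∷  -95 ∷   29 ∷   -8 ∷   32 ∷  -36 ∷   54 ∷    0 ∷    0 ∷    0 ∷    0 ∷    0 ∷ [])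
    ∷ (   0 ∷  -49 ∷   55 ∷  -21 ∷   43 ∷  -76 ∷  104 ∷  -80 ∷   24 ∷    0 ∷    0 ∷    0 ∷    0 ∷ [])
    ∷ (   0 ∷    0 ∷   -3 ∷   41 ∷  -93 ∷   65 ∷  -18 ∷   82 ∷  -96 ∷   22 ∷    0 ∷    0 ∷    0 ∷ [])
    ∷ (   0 ∷    0 ∷    0 ∷  -39 ∷   17 ∷  -33 ∷   37 ∷  -62 ∷   66 ∷  -14 ∷   28 ∷    0 ∷    0 ∷ [])
    ∷ (   0 ∷    0 ∷    0 ∷    0 ∷  -51 ∷   15 ∷  -61 ∷   89 ∷  -68 ∷   86 ∷  -94 ∷   84 ∷    0 ∷ [])
    ∷ (   0 ∷    0 ∷    0 ∷    0 ∷    0 ∷  -31 ∷   25 ∷  -85 ∷   57 ∷  -46 ∷  100 ∷  -90 ∷   70 ∷ [])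
    ∷ (  78 ∷    0 ∷    0 ∷    0 ∷    0 ∷    0 ∷ -103 ∷   11 ∷   -7 ∷   47 ∷  -72 ∷   50 ∷   -4 ∷ [])
    ∷ (-102 ∷   34 ∷    0 ∷    0 ∷    0 ∷    0 ∷    0 ∷   -9 ∷   69 ∷  -79 ∷   83 ∷   -2 ∷    6 ∷ [])
    ∷ (  42 ∷  -98 ∷   88 ∷    0 ∷    0 ∷    0 ∷    0 ∷    0 ∷  -45 ∷   59 ∷  -27 ∷   19 ∷  -38 ∷ [])
    ∷ ( -10 ∷   20 ∷  -56 ∷   64 ∷    0 ∷    0 ∷    0 ∷    0 ∷    0 ∷  -75 ∷   63 ∷  -73 ∷   67 ∷ [])
    ∷ (  53 ∷  -16 ∷   58 ∷  -92 ∷   48 ∷    0 ∷    0 ∷    0 ∷    0 ∷    0 ∷  -81 ∷   35 ∷   -5 ∷ [])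
    ∷ ( -71 ∷   99 ∷  -60 ∷   44 ∷  -30 ∷   40 ∷    0 ∷    0 ∷    0 ∷    0 ∷    0 ∷  -23 ∷    1 ∷ [])
    ∷ (  87 ∷  -91 ∷   13 ∷  -26 ∷   74 ∷  -12 ∷   52 ∷    0 ∷    0 ∷    0 ∷    0 ∷    0 ∷  -97 ∷ [])
    ∷ []

  H₁₅ : Vec (Vec ℤ 15) 15
  H₁₅ =
      (  -7 ∷   37 ∷  -55 ∷   11 ∷   -6 ∷   96 ∷  -80 ∷    4 ∷    0 ∷    0 ∷    0 ∷    0 ∷    0 ∷    0 ∷    0 ∷ [])
    ∷ (   0 ∷  -19 ∷   27 ∷   -3 ∷    1 ∷  -56 ∷   42 ∷  -64 ∷   72 ∷    0 ∷    0 ∷    0 ∷    0 ∷    0 ∷    0 ∷ [])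
    ∷ (   0 ∷    0 ∷  -21 ∷   31 ∷  -15 ∷   39 ∷  -48 ∷  110 ∷ -112 ∷   16 ∷    0 ∷    0 ∷    0 ∷    0 ∷    0 ∷ [])
    ∷ (   0 ∷    0 ∷    0 ∷  -23 ∷    9 ∷  -51 ∷  113 ∷ -118 ∷  104 ∷  -54 ∷   20 ∷    0 ∷    0 ∷    0 ∷    0 ∷ [])
    ∷ (   0 ∷    0 ∷    0 ∷    0 ∷  -13 ∷   41 ∷ -117 ∷   61 ∷  -62 ∷   98 ∷  -86 ∷   78 ∷    0 ∷    0 ∷    0 ∷ [])
    ∷ (   0 ∷    0 ∷    0 ∷    0 ∷    0 ∷  -65 ∷   49 ∷  -73 ∷   91 ∷  -74 ∷   84 ∷ -120 ∷  108 ∷    0 ∷    0 ∷ [])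
    ∷ (   0 ∷    0 ∷    0 ∷    0 ∷    0 ∷    0 ∷  -75 ∷  115 ∷  -97 ∷   99 ∷  -34 ∷   30 ∷  -70 ∷   32 ∷    0 ∷ [])
    ∷ (   0 ∷    0 ∷    0 ∷    0 ∷    0 ∷    0 ∷    0 ∷  -35 ∷   71 ∷ -111 ∷   95 ∷  -22 ∷   26 ∷  -38 ∷   14 ∷ [])
    ∷ (  40 ∷    0 ∷    0 ∷    0 ∷    0 ∷    0 ∷    0 ∷    0 ∷  -67 ∷   43 ∷  -93 ∷  109 ∷  -28 ∷    8 ∷  -12 ∷ [])
    ∷ ( -82 ∷   46 ∷    0 ∷    0 ∷    0 ∷    0 ∷    0 ∷    0 ∷    0 ∷  -17 ∷   83 ∷  -63 ∷   25 ∷  -58 ∷   66 ∷ [])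
    ∷ (  68 ∷  -60 ∷   18 ∷    0 ∷    0 ∷    0 ∷    0 ∷    0 ∷    0 ∷    0 ∷  -69 ∷   45 ∷   -5 ∷  105 ∷ -102 ∷ [])
    ∷ (-106 ∷   52 ∷  -10 ∷   50 ∷    0 ∷    0 ∷    0 ∷    0 ∷    0 ∷    0 ∷    0 ∷  -57 ∷   47 ∷  -77 ∷  101 ∷ [])
    ∷ (  53 ∷   -2 ∷   36 ∷  -76 ∷   44 ∷    0 ∷    0 ∷    0 ∷    0 ∷    0 ∷    0 ∷    0 ∷ -103 ∷  107 ∷  -59 ∷ [])
    ∷ ( -85 ∷   33 ∷  -24 ∷  100 ∷ -114 ∷   88 ∷    0 ∷    0 ∷    0 ∷    0 ∷    0 ∷    0 ∷    0 ∷  -79 ∷   81 ∷ [])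
    ∷ ( 119 ∷  -87 ∷   29 ∷  -90 ∷   94 ∷  -92 ∷  116 ∷    0 ∷    0 ∷    0 ∷    0 ∷    0 ∷    0 ∷    0 ∷  -89 ∷ [])
    ∷ []

open BaseArrays using (H₈; H₉; H₁₁; H₁₃; H₁₅)

H₈-zigzag : Linewise (ZigzagLine 8) 8 8 (fromRows H₈)
H₈-zigzag = fromRows-linewise (zigzagLine? 8) 8 H₈

H₉-simple : Linewise (SimpleLine 8) 9 8 (fromRows H₉)
H₉-simple = fromRows-linewise (simpleLine? 8) 8 H₉

H₁₁-simple : Linewise (SimpleLine 8) 11 8 (fromRows H₁₁)
H₁₁-simple = fromRows-linewise (simpleLine? 8) 8 H₁₁

H₁₃-simple : Linewise (SimpleLine 8) 13 8 (fromRows H₁₃)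
H₁₃-simple = fromRows-linewise (simpleLine? 8) 8 H₁₃

H₁₅-simple : Linewise (SimpleLine 8) 15 8 (fromRows H₁₅)
H₁₅-simple = fromRows-linewise (simpleLine? 8) 8 H₁₅

data SmallOddOrder : ℕ → Set where
  nine     : SmallOddOrder 9
  eleven   : SmallOddOrder 11
  thirteen : SmallOddOrder 13
  fifteen  : SmallOddOrder 15

smallOdd-base : ∀ {s} → SmallOddOrder s → Σ (PArray s) (Linewise (SimpleLine 8) s 8)
smallOdd-base nine     = fromRows H₉  , H₉-simple
smallOdd-base eleven   = fromRows H₁₁ , H₁₁-simple
smallOdd-base thirteen = fromRows H₁₃ , H₁₃-simple
smallOdd-base fifteen  = fromRows H₁₅ , H₁₅-simple

odd-decomposition : ∀ m → (9 ℕ.+ m) % 2 ≡ 1 →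
                    Σ ℕ λ s → SmallOddOrder s × ∃ λ a → 9 ℕ.+ m ≡ s ℕ.+ a ℕ.* 8
odd-decomposition 0 _ = 9  , nine     , 0 , refl
odd-decomposition 2 _ = 11 , eleven   , 0 , refl
odd-decomposition 4 _ = 13 , thirteen , 0 , refl
odd-decomposition 6 _ = 15 , fifteen  , 0 , refl
odd-decomposition (suc (suc (suc (suc (suc (suc (suc (suc m)))))))) odd
  with odd-decomposition m odd
... | s , small , a , eq = s , small , suc a , (begin
  8 ℕ.+ (9 ℕ.+ m)        ≡⟨ cong (8 ℕ.+_) eq ⟩
  8 ℕ.+ (s ℕ.+ a ℕ.* 8)  ≡⟨ ℕP.+-assoc 8 s (a ℕ.* 8) ⟨
  8 ℕ.+ s ℕ.+ a ℕ.* 8    ≡⟨ cong (ℕ._+ a ℕ.* 8) (ℕP.+-comm 8 s) ⟩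
  s ℕ.+ 8 ℕ.+ a ℕ.* 8    ≡⟨ ℕP.+-assoc s 8 (a ℕ.* 8) ⟩
  s ℕ.+ suc a ℕ.* 8      ∎)
  where open ≡-Reasoning

SHStar : ℕ → ℕ → Set
SHStar n k = ∃ λ (A : PArray n) → IsSHStar n k A

smallOdd+8a : ∀ {s} → SmallOddOrder s → ∀ a → SHStar (s ℕ.+ a ℕ.* 8) 8
smallOdd+8a {s} small a with smallOdd-base small
... | B , B-simple =
  B ⊕⟨ s ℕ.* 8 ⟩ blockPower 8 (fromRows H₈) a ,
  linewise⇒SHStar
    (⊕-linewise simpleLine-mono (λ c → zigzagLine⇒simpleLine ∘ zigzagLine-shiftAbs c) B-simple
      (blockPower-linewise zigzagLine-mono zigzagLine-shiftAbs H₈-zigzag a))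

proposition4p7 : (n : ℕ) → 9 ≤ n → n % 2 ≡ 1 → ∃ λ (A : PArray n) → IsSHStar n 8 A
proposition4p7 n 9≤n odd with ℕP.m≤n⇒∃[o]m+o≡n 9≤n
... | m , refl with odd-decomposition m odd
...   | s , small , a , n≡s+8a = subst (λ n → SHStar n 8) (sym n≡s+8a) (smallOdd+8a small a)
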